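{- Let $\epsilon>0$ and let $k\ge 0$ be an integer. Let $(G,\mu)$ be an $(\epsilon,2)$-coherent massed graph, and let $A_1,\ldots,A_k,B_1,\ldots,B_k,C_1,\ldots,C_k$ be a $k$-ladder in $G$ such that $\mu(C_i)\ge 3k\epsilon$ for $1\le i\le k$. Let $A=\bigcup_i A_i$, $B=\bigcup_i B_i$, $C=\bigcup_i C_i$. For $1\le i\le k$ let $b_i\in B_i$, such that $b_1,\ldots,b_k$ are pairwise nonadjacent. Then every pairing of $\{b_1,\ldots,b_k\}$ is feasible in $G[A\cup B\cup C]$.
   Context: All graphs are finite, without loops or parallel edges. Disjoint sets $A,B$ are anticomplete if no vertex of $A$ has a neighbour in $B$; $A$ covers $B$ if every vertex of $B$ has a neighbour in $A$. $X$ is connected if $G[X]$ is connected. $N^r[v]$ denotes the set of vertices of $G$ at distance at most $r$ from $v$ in $G$. A mass on $G$ is a function $\mu$ assigning a real $\mu(X)$ to each $X\subseteq V(G)$ with $\mu(\emptyset)=0$, $\mu(V(G))=1$, $\mu(X)\le\mu(Y)$ for $X\subseteq Y$, and $\mu(X\cup Y)\le\mu(X)+\mu(Y)$ for disjoint $X,Y$; $(G,\mu)$ is a massed graph. For an integer $r\ge1$, $(G,\mu)$ is $(\epsilon,r)$-coherent if $\mu(N^r[v])<\epsilon$ for every vertex $v$ and $\min(\mu(A),\mu(B))<\epsilon$ for every two anticomplete sets of vertices $A,B$. A $k$-ladder in $G$ is a family of $3k$ pairwise disjoint subsets $A_1,\ldots,A_k,B_1,\ldots,B_k,C_1,\ldots,C_k$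 of $V(G)$ such that for $1\le i\le k$, $A_i$ is connected and covers $B_i$, and $B_i$ covers $C_i$; for $1\le i\le k$, $A_i,C_i$ are anticomplete; and for all distinct $i,j$, $A_i$ is anticomplete to $A_j\cup B_j\cup C_j$. A pairing of a set $X$ is a set $\Pi$ of pairwise disjoint subsets of $X$, each of cardinality one or two, whose union is $X$. A pairing $\Pi$ is feasible in a graph $G'$ if for each $e\in\Pi$ with $|e|=2$ there is an induced path $P_e$ of $G'$ joining the two members of $e$, and for $|e|=1$, $P_e$ is the one-vertex path with vertex set $e$, such that for all distinct $e,f\in\Pi$ the sets $V(P_e),V(P_f)$ are anticomplete. -}

module Defs where

open import Level using (Level; 0ℓ) renaming (suc to lsuc)
open import Data.Nat using (ℕ; zero; suc; _*_)
open import Data.Fin using (Fin; toℕ)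
open import Data.Fin.Subset using (Subset; _∈_; _∉_; _⊆_; _∪_; ⊥; ⊤)
open import Data.Product using (Σ; ∃; ∃-syntax; _×_; _,_)
open import Data.Sum using (_⊎_)
open import Data.List using (List; length; lookup)
open import Relation.Nullary using (¬_; Dec)
open import Relation.Binary using (Tri)
open import Relation.Binary.PropositionalEquality using (_≡_; _≢_)
open import Algebra.Structures using (IsCommutativeRing)
import Data.Empty as E
import Data.Fin as F

-- The real numbers, axiomatised as a Dedekind-complete ordered field
-- (any model is isomorphic to ℝ).  Equality is propositional.

record Reals : Set₁ where
  infixl 6 _+_
  infixl 7 _·_
  infix 4 _<_
  field
    Carrier : Set
    _+_ _·_ : Carrier → Carrier → Carrier
    -_ : Carrier → Carrier
    0r 1r : Carrier
    isCommutativeRing : IsCommutativeRing _≡_ _+_ _·_ -_ 0r 1r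
    0≢1 : 0r ≢ 1r
    inverse : ∀ x → x ≢ 0r → ∃[ y ] (x · y ≡ 1r)
    _<_ : Carrier → Carrier → Set
    <-irrefl : ∀ x → ¬ (x < x)
    <-trans : ∀ {x y z} → x < y → y < z → x < z
    <-tri : ∀ x y → Tri (x < y) (x ≡ y) (y < x)
    +-mono-< : ∀ {x y} z → x < y → x + z < y + z
    ·-pos : ∀ {x y} → 0r < x → 0r < y → 0r < x · y
    complete : (P : Carrier → Set) → ∃[ x ] P x →
               ∃[ b ] (∀ y → P y → (y < b ⊎ y ≡ b)) →
               ∃[ s ] ((∀ y → P y → (y < s ⊎ y ≡ s)) ×
                       (∀ b → (∀ y → P y → (y < b ⊎ y ≡ b)) → (s < b ⊎ s ≡ b)))

  infix 4 _≤_
  _≤_ : Carrier → Carrier → Set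
  x ≤ y = x < y ⊎ x ≡ y

  infixr 8 _×ℕ_
  _×ℕ_ : ℕ → Carrier → Carrier
  zero ×ℕ x = 0r
  suc m ×ℕ x = x + (m ×ℕ x)

record Graph : Set₁ where
  field
    n : ℕ
    Adj : Fin n → Fin n → Set
    adj? : ∀ u v → Dec (Adj u v)
    adj-sym : ∀ {u v} → Adj u v → Adj v u
    adj-irrefl : ∀ u → ¬ Adj u u

module _ (G : Graph) where
  open Graph G

  VSet : Set
  VSet = Subset n

  Disjoint : VSet → VSet → Set
  Disjoint X Y = ∀ v → v ∈ X → v ∈ Y → E.⊥

  Anticomplete : VSet → VSet → Set
  Anticomplete X Y = ∀ u v → u ∈ X → v ∈ Y → ¬ Adj u v

  Covers : VSet → VSet → Set
  Covers X Y = ∀ v → v ∈ Y → ∃[ u ] (u ∈ X × Adj u v)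

  data WalkIn (X : VSet) : Fin n → Fin n → Set where
    here : ∀ {u} → u ∈ X → WalkIn X u u
    step : ∀ {u v w} → u ∈ X → Adj u v → WalkIn X v w → WalkIn X u w

  Connected : VSet → Set
  Connected X = ∀ u v → u ∈ X → v ∈ X → WalkIn X u v

  data Reach : ℕ → Fin n → Fin n → Set where
    here : ∀ {r u} → Reach r u u
    step : ∀ {r u v w} → Adj u v → Reach r v w → Reach (suc r) u w

  IsBall : ℕ → Fin n → VSet → Set
  IsBall r v X = ∀ u → (u ∈ X → Reach r v u) × (Reach r v u → u ∈ X)

  module _ (ℝ : Reals) where
    open Reals ℝ

    record Mass : Set where
      field
        μ : VSet → Carrier
        μ-empty : μ ⊥ ≡ 0r
        μ-full : μ ⊤ ≡ 1r
        μ-mono : ∀ {X Y} → X ⊆ Y → μ X ≤ μ Y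
        μ-subadd : ∀ X Y → Disjoint X Y → μ (X ∪ Y) ≤ μ X + μ Y

    Coherent : Mass → Carrier → ℕ → Set
    Coherent m ε r =
      (∀ v X → IsBall r v X → Mass.μ m X < ε) ×
      (∀ X Y → Disjoint X Y → Anticomplete X Y →
         (Mass.μ m X < ε ⊎ Mass.μ m Y < ε))

  module _ {k : ℕ} (A B C : Fin k → VSet) where
    ladderSet : Fin 3 → Fin k → VSet
    ladderSet F.zero i = A i
    ladderSet (F.suc F.zero) i = B i
    ladderSet (F.suc (F.suc F.zero)) i = C i

    record IsLadder : Set where
      field
        pairwiseDisjoint : ∀ s i t j → (s , i) ≢ (t , j) →
                           Disjoint (ladderSet s i) (ladderSet t j)
        A-connected : ∀ i → Connected (A i)
        A-covers-B : ∀ i → Covers (A i) (B i)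
        B-covers-C : ∀ i → Covers (B i) (C i)
        A-anti-C : ∀ i → Anticomplete (A i) (C i)
        A-anti-other : ∀ i j → i ≢ j →
                       Anticomplete (A i) ((A j ∪ B j) ∪ C j)

  -- induced paths of G with all vertices in the set Z
  -- (i.e. induced paths of G[Z]); vertices p 0, ..., p len
  record InducedPathIn (Z : VSet) (x y : Fin n) : Set where
    field
      len : ℕ
      p : Fin (suc len) → Fin n
      p-start : p F.zero ≡ x
      p-end : p (F.fromℕ len) ≡ y
      p-inj : ∀ i j → p i ≡ p j → i ≡ j
      p-in : ∀ i → p i ∈ Z
      p-adj : ∀ i j → toℕ j ≡ suc (toℕ i) → Adj (p i) (p j)
      p-induced : ∀ i j → Adj (p i) (p j) →
                  (toℕ j ≡ suc (toℕ i) ⊎ toℕ i ≡ suc (toℕ j))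

  _∈P_ : ∀ {Z x y} → Fin n → InducedPathIn Z x y → Set
  u ∈P P = ∃[ i ] (InducedPathIn.p P i ≡ u)

  data Block : Set where
    single : Fin n → Block
    pair : Fin n → Fin n → Block

  _∈B_ : Fin n → Block → Set
  u ∈B single x = u ≡ x
  u ∈B pair x y = u ≡ x ⊎ u ≡ y

  record IsPairing (S : Fin n → Set) (Π : List Block) : Set where
    field
      pair-distinct : ∀ e x y → lookup Π e ≡ pair x y → x ≢ y
      blocks-disjoint : ∀ e f → e ≢ f → ∀ u → u ∈B lookup Π e → ¬ (u ∈B lookup Π f)
      blocks-⊆ : ∀ e u → u ∈B lookup Π e → S u
      blocks-cover : ∀ u → S u → ∃[ e ] (u ∈B lookup Π e)

  BlockPath : VSet → Block → Set
  BlockPath Z (single x) = Σ (InducedPathIn Z x x) λ P → InducedPathIn.len P ≡ 0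
  BlockPath Z (pair x y) = InducedPathIn Z x y

  blockPathVertex : ∀ {Z} e → BlockPath Z e → Fin n → Set
  blockPathVertex (single x) (P , _) u = u ∈P P
  blockPathVertex (pair x y) P u = u ∈P P

  Feasible : VSet → List Block → Set
  Feasible Z Π =
    Σ ((e : Fin (length Π)) → BlockPath Z (lookup Π e)) λ P →
      ∀ e f → e ≢ f →
        (∀ u → blockPathVertex (lookup Π e) (P e) u →
               ¬ blockPathVertex (lookup Π f) (P f) u) ×
        (∀ u v → blockPathVertex (lookup Π e) (P e) u →
                 blockPathVertex (lookup Π f) (P f) v → ¬ Adj u v)

  ⋃ : ∀ {k} → (Fin k → VSet) → VSet
  ⋃ {zero} F = ⊥
  ⋃ {suc k} F = F F.zero ∪ ⋃ (λ i → F (F.suc i))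

-- The blocks of the pairing are served one after another, each by an induced
-- path on the rungs of its indices.  A singleton {b i} gets the one-vertex
-- path.  For a pair {b i, b j} we pick adjacent ci ∈ C i and cj ∈ C j at
-- distance more than 2 from every vertex used so far: all b's, plus at most
-- two "extra" vertices of B ∪ C per earlier index -- fewer than 3k vertices.
-- Their 2-balls have mass < ε each, so what remains of C i and of C j still
-- has mass ≥ ε, and coherence makes the two remainders adjacent.  The walk
-- b i – A i – b′i – ci – cj – b′j – A j – b j (b′ ∈ B covering c) contains an
-- induced path.  Paths of different blocks are far apart because A i is
-- anticomplete to the other rungs, the b's are pairwise nonadjacent, and new
-- extra vertices are far from everything used before.
module Submission where

open import Defs
open import Data.Nat as ℕ using (ℕ; zero; suc; _*_)
open import Data.Nat.Properties as ℕₚ using (+-mono-≤; *-suc)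
open import Data.Fin as F using (Fin; toℕ)
open import Data.Fin.Properties using (any?) renaming (_≟_ to _≟F_; suc-injective to Fin-suc-injective)
open import Data.Fin.Subset using (Subset; _∈_; _∪_; _⊆_)
open import Data.Fin.Subset.Properties using (_∈?_; x∈p∪q⁺)
open import Data.Vec using (tabulate)
open import Data.Vec.Properties using (lookup∘tabulate; []=⇒lookup; lookup⇒[]=)
open import Data.Sum using (_⊎_; inj₁; inj₂; [_,_]′)
open import Data.Product using (Σ; ∃-syntax; _×_; _,_; proj₁; proj₂)
open import Data.Empty using (⊥-elim)
open import Data.List as List using (List; []; _∷_; length; concat)
open import Data.List.Properties using (length-++)
open import Data.List.Relation.Unary.All as All using (All; []; _∷_)
open import Data.List.Relation.Unary.All.Properties using (¬Any⇒All¬)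
open import Data.List.Relation.Unary.Any.Properties using (¬Any[])
open import Data.List.Relation.Unary.Any as Any using (Any; here; there)
open import Data.List.Relation.Binary.Subset.Propositional renaming (_⊆_ to _⊆ₗ_)
open import Data.List.Membership.Propositional renaming (_∈_ to _∈ₗ_)
open import Data.List.Membership.Propositional.Properties using (∈-lookup; ∈-concat⁺′; ∈-tabulate⁺)
open import Relation.Binary.PropositionalEquality
open import Relation.Nullary using (¬_; Dec; yes; no; does)
open import Relation.Nullary.Decidable using (_×-dec_; _⊎-dec_; ¬?; dec-true)
open import Relation.Unary using (Pred; Decidable)
open import Level using (0ℓ)
open import Function using (id; _∘_; const)
open import Data.Vec.Functional using (updateAt)
open import Data.Vec.Functional.Properties using (updateAt-updates; updateAt-minimal)
open import Algebra.Structures using (IsCommutativeRing)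

module OrderedFieldFacts (ℝ : Reals) where
  open Reals ℝ
  open IsCommutativeRing isCommutativeRing using (+-comm; +-assoc; +-identityˡ)

  ≤-refl : ∀ {x} → x ≤ x
  ≤-refl = inj₂ refl

  <-≤-trans : ∀ {x y z} → x < y → y ≤ z → x < z
  <-≤-trans x<y (inj₁ y<z) = <-trans x<y y<z
  <-≤-trans x<y (inj₂ refl) = x<y

  ≤-<-trans : ∀ {x y z} → x ≤ y → y < z → x < z
  ≤-<-trans (inj₁ x<y) y<z = <-trans x<y y<z
  ≤-<-trans (inj₂ refl) y<z = y<z

  ≤-trans : ∀ {x y z} → x ≤ y → y ≤ z → x ≤ z
  ≤-trans (inj₁ x<y) y≤z = inj₁ (<-≤-trans x<y y≤z)
  ≤-trans (inj₂ refl) y≤z = y≤z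

  +-monoˡ-≤ : ∀ {x y} z → x ≤ y → x + z ≤ y + z
  +-monoˡ-≤ z (inj₁ x<y) = inj₁ (+-mono-< z x<y)
  +-monoˡ-≤ z (inj₂ refl) = ≤-refl

  +-monoʳ-≤ : ∀ {x y} z → x ≤ y → z + x ≤ z + y
  +-monoʳ-≤ {x} {y} z (inj₁ x<y) = inj₁ (subst₂ _<_ (+-comm x z) (+-comm y z) (+-mono-< z x<y))
  +-monoʳ-≤ z (inj₂ refl) = ≤-refl

  +-mono-≤′ : ∀ {x y u v} → x ≤ y → u ≤ v → x + u ≤ y + v
  +-mono-≤′ {y = y} {u = u} x≤y u≤v = ≤-trans (+-monoˡ-≤ u x≤y) (+-monoʳ-≤ y u≤v)

  0≤×ℕ : ∀ {e} → 0r ≤ e → ∀ m → 0r ≤ m ×ℕ e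
  0≤×ℕ 0≤e zero = ≤-refl
  0≤×ℕ {e} 0≤e (suc m) = subst (_≤ e + m ×ℕ e) (+-identityˡ 0r) (+-mono-≤′ 0≤e (0≤×ℕ 0≤e m))

  ×ℕ-mono : ∀ {e} → 0r ≤ e → ∀ {m m′} → m ℕ.≤ m′ → m ×ℕ e ≤ m′ ×ℕ e
  ×ℕ-mono 0≤e {zero} {m′} _ = 0≤×ℕ 0≤e m′
  ×ℕ-mono {e} 0≤e {suc m} {suc m′} (ℕ.s≤s m≤m′) = +-monoʳ-≤ e (×ℕ-mono 0≤e m≤m′)

module _ {n : ℕ} {P : Pred (Fin n) 0ℓ} where
  subsetOf : Decidable P → Subset n
  subsetOf P? = tabulate (λ u → does (P? u))

  ∈-subsetOf⁻ : (P? : Decidable P) → ∀ {u} → u ∈ subsetOf P? → P u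
  ∈-subsetOf⁻ P? {u} u∈ with P? u | trans (sym (lookup∘tabulate (λ u → does (P? u)) u)) ([]=⇒lookup u∈)
  ... | yes pu | _ = pu
  ... | no _ | ()

  ∈-subsetOf⁺ : (P? : Decidable P) → ∀ {u} → P u → u ∈ subsetOf P?
  ∈-subsetOf⁺ P? {u} pu =
    lookup⇒[]= u _ (trans (lookup∘tabulate (λ u → does (P? u)) u) (dec-true (P? u) pu))

module GraphFacts (G : Graph) where
  open Graph G

  V : Set
  V = Fin n

  reach? : ∀ r u w → Dec (Reach G r u w)
  reach? zero u w with u ≟F w
  ... | yes refl = yes here
  ... | no u≢w = no λ { here → u≢w refl }
  reach? (suc r) u w with u ≟F w
  ... | yes refl = yes here
  ... | no u≢w with any? (λ v → adj? u v ×-dec reach? r v w)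
  ... | yes (v , u~v , v→w) = yes (step u~v v→w)
  ... | no none = no λ { here → u≢w refl ; (step u~v v→w) → none (_ , u~v , v→w) }

  ball : V → VSet G
  ball v = subsetOf (reach? 2 v)

  ball-isBall : ∀ v → IsBall G 2 v (ball v)
  ball-isBall v u = ∈-subsetOf⁻ (reach? 2 v) , ∈-subsetOf⁺ (reach? 2 v)

  -- Two vertices are far apart if they are distinct and nonadjacent; this
  -- is exactly what the feasibility of a pairing asks between paths.
  Far : V → V → Set
  Far u v = u ≢ v × ¬ Adj u v

  far-sym : ∀ {u v} → Far u v → Far v u
  far-sym (u≢v , u≁v) = (λ v≡u → u≢v (sym v≡u)) , (λ v~u → u≁v (adj-sym v~u))

  far-centre : ∀ {t c} → ¬ Reach G 2 t c → Far c t
  far-centre t↛c = (λ { refl → t↛c here }) , (λ c~t → t↛c (step (adj-sym c~t) here))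

  far-neighbour : ∀ {t c w} → ¬ Reach G 2 t c → Adj w c → Far w t
  far-neighbour t↛c w~c =
    (λ { refl → t↛c (step w~c here) }) , (λ w~t → t↛c (step (adj-sym w~t) (step w~c here)))

  ∈-⋃ : ∀ {k} (F : Fin k → VSet G) i {v} → v ∈ F i → v ∈ ⋃ G F
  ∈-⋃ F F.zero v∈ = x∈p∪q⁺ (inj₁ v∈)
  ∈-⋃ F (F.suc i) v∈ = x∈p∪q⁺ (inj₂ (∈-⋃ (F ∘ F.suc) i v∈))

  _∈B?_ : ∀ u blk → Dec (_∈B_ G u blk)
  u ∈B? single x = u ≟F x
  u ∈B? pair x y = (u ≟F x) ⊎-dec (u ≟F y)

  data Walk (Q : V → Set) : V → V → Set where
    here : ∀ {u} → Q u → Walk Q u u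
    step : ∀ {u v w} → Q u → Adj u v → Walk Q v w → Walk Q u w

  _++W_ : ∀ {Q u v w} → Walk Q u v → Walk Q v w → Walk Q u w
  here _ ++W W′ = W′
  step qu u~v W ++W W′ = step qu u~v (W ++W W′)

  walkIn⇒walk : ∀ {X Q} → (∀ {u} → u ∈ X → Q u) → ∀ {u v} → WalkIn G X u v → Walk Q u v
  walkIn⇒walk X⊆Q (here u∈X) = here (X⊆Q u∈X)
  walkIn⇒walk X⊆Q (step u∈X u~v W) = step (X⊆Q u∈X) u~v (walkIn⇒walk X⊆Q W)

  mapWalk : ∀ {Q Q′} → (∀ {u} → Q u → Q′ u) → ∀ {u v} → Walk Q u v → Walk Q′ u v
  mapWalk f (here qu) = here (f qu)
  mapWalk f (step qu u~v W) = step (f qu) u~v (mapWalk f W)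

  walk-start : ∀ {Q u v} → Walk Q u v → Q u
  walk-start (here qu) = qu
  walk-start (step qu _ _) = qu

  reverseWalk : ∀ {Q u v} → Walk Q u v → Walk Q v u
  reverseWalk (here qu) = here qu
  reverseWalk (step qu u~v W) = reverseWalk W ++W step (walk-start W) (adj-sym u~v) (here qu)

  -- InducedList x y xs: the sequence x ∷ xs is an induced path from x to y;
  -- each vertex is far from every vertex after its successor.
  data InducedList : V → V → List V → Set where
    end : ∀ {y} → InducedList y y []
    link : ∀ {u v y xs} → Adj u v → All (Far u) xs → InducedList v y xs → InducedList u y (v ∷ xs)

  Near : V → V → Set
  Near u w = u ≡ w ⊎ Adj u w

  near? : ∀ u w → Dec (Near u w)
  near? u w = (u ≟F w) ⊎-dec (adj? u w)

  -- If u is equal or adjacent to some vertex of an induced path to y, then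
  -- jumping from u to the last such vertex gives an induced path from u to y
  -- using only vertices of the old path.
  shortcut : ∀ u {x y xs} → InducedList x y xs → Any (Near u) (x ∷ xs) →
             ∃[ ys ] (InducedList u y ys × ys ⊆ₗ x ∷ xs)
  shortcut u end (here (inj₁ refl)) = [] , end , λ ()
  shortcut u end (here (inj₂ u~y)) = _ , link u~y [] end , id
  shortcut u {x} (link {v = v} {xs = xs} x~v x-far P) near with Any.any? (near? u) (v ∷ xs)
  ... | yes nearLater with shortcut u P nearLater
  ...   | ys , Q , ys⊆ = ys , Q , there ∘ ys⊆
  shortcut u {x} (link x~v x-far P) (here (inj₁ refl)) | no _ = _ , link x~v x-far P , there
  shortcut u {x} (link {v = v} {xs = xs} x~v x-far P) (here (inj₂ u~x)) | no notLater =
    x ∷ v ∷ xs , link u~x (All.map ¬near⇒far (¬Any⇒All¬ (v ∷ xs) notLater)) (link x~v x-far P) , id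
    where
      ¬near⇒far : ∀ {w} → ¬ Near u w → Far u w
      ¬near⇒far ¬near = (λ u≡w → ¬near (inj₁ u≡w)) , (λ u~w → ¬near (inj₂ u~w))
  shortcut u (link x~v x-far P) (there nearLater) | no notLater = ⊥-elim (notLater nearLater)

  walk⇒inducedList : ∀ {Q x y} → Walk Q x y → ∃[ xs ] (InducedList x y xs × All Q (x ∷ xs))
  walk⇒inducedList (here qx) = [] , end , qx ∷ []
  walk⇒inducedList (step qx x~v W) with walk⇒inducedList W
  ... | xs , P , allQ with shortcut _ P (here (inj₂ x~v))
  ...   | ys , P′ , ys⊆ = ys , P′ , qx ∷ All.tabulate (All.lookup allQ ∘ ys⊆)

  inducedList-end : ∀ {x y xs} → InducedList x y xs →
                    List.lookup (x ∷ xs) (F.fromℕ (length xs)) ≡ y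
  inducedList-end end = refl
  inducedList-end (link _ _ P) = inducedList-end P

  inducedList-injective : ∀ {x y xs} → InducedList x y xs →
                          ∀ i j → List.lookup (x ∷ xs) i ≡ List.lookup (x ∷ xs) j → i ≡ j
  inducedList-injective end F.zero F.zero _ = refl
  inducedList-injective (link _ _ _) F.zero F.zero _ = refl
  inducedList-injective (link x~v _ _) F.zero (F.suc F.zero) refl = ⊥-elim (adj-irrefl _ x~v)
  inducedList-injective (link _ x-far _) F.zero (F.suc (F.suc j)) eq =
    ⊥-elim (proj₁ (All.lookup x-far (∈-lookup j)) eq)
  inducedList-injective (link x~v _ _) (F.suc F.zero) F.zero refl = ⊥-elim (adj-irrefl _ x~v)
  inducedList-injective (link _ x-far _) (F.suc (F.suc i)) F.zero eq =
    ⊥-elim (proj₁ (All.lookup x-far (∈-lookup i)) (sym eq))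
  inducedList-injective (link _ _ P) (F.suc i) (F.suc j) eq =
    cong F.suc (inducedList-injective P i j eq)

  inducedList-adjacent : ∀ {x y xs} → InducedList x y xs →
                         ∀ i j → toℕ j ≡ suc (toℕ i) →
                         Adj (List.lookup (x ∷ xs) i) (List.lookup (x ∷ xs) j)
  inducedList-adjacent (link x~v _ _) F.zero (F.suc F.zero) _ = x~v
  inducedList-adjacent (link _ _ _) F.zero (F.suc (F.suc j)) eq with ℕₚ.suc-injective eq
  ... | ()
  inducedList-adjacent (link _ _ P) (F.suc i) (F.suc j) eq =
    inducedList-adjacent P i j (ℕₚ.suc-injective eq)

  inducedList-induced : ∀ {x y xs} → InducedList x y xs →
                        ∀ i j → Adj (List.lookup (x ∷ xs) i) (List.lookup (x ∷ xs) j) →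
                        toℕ j ≡ suc (toℕ i) ⊎ toℕ i ≡ suc (toℕ j)
  inducedList-induced end F.zero F.zero x~x = ⊥-elim (adj-irrefl _ x~x)
  inducedList-induced (link _ _ _) F.zero F.zero x~x = ⊥-elim (adj-irrefl _ x~x)
  inducedList-induced (link _ _ _) F.zero (F.suc F.zero) _ = inj₁ refl
  inducedList-induced (link _ x-far _) F.zero (F.suc (F.suc j)) x~w =
    ⊥-elim (proj₂ (All.lookup x-far (∈-lookup j)) x~w)
  inducedList-induced (link _ _ _) (F.suc F.zero) F.zero _ = inj₂ refl
  inducedList-induced (link _ x-far _) (F.suc (F.suc i)) F.zero w~x =
    ⊥-elim (proj₂ (All.lookup x-far (∈-lookup i)) (adj-sym w~x))
  inducedList-induced (link _ _ P) (F.suc i) (F.suc j) u~w with inducedList-induced P i j u~w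
  ... | inj₁ eq = inj₁ (cong suc eq)
  ... | inj₂ eq = inj₂ (cong suc eq)

  toInducedPathIn : ∀ {x y xs Z} → InducedList x y xs → All (_∈ Z) (x ∷ xs) → InducedPathIn G Z x y
  toInducedPathIn {x} {xs = xs} P inZ = record
    { len = length xs
    ; p = List.lookup (x ∷ xs)
    ; p-start = refl
    ; p-end = inducedList-end P
    ; p-inj = inducedList-injective P
    ; p-in = λ i → All.lookup inZ (∈-lookup i)
    ; p-adj = inducedList-adjacent P
    ; p-induced = inducedList-induced P }

  ∈-toInducedPathIn : ∀ {x y xs Z} (P : InducedList x y xs) (inZ : All (_∈ Z) (x ∷ xs)) →
                      ∀ {u} → _∈P_ G u (toInducedPathIn P inZ) → u ∈ₗ x ∷ xs
  ∈-toInducedPathIn P inZ (i , refl) = ∈-lookup i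

module MassFacts (ℝ : Reals) (G : Graph) (m : Mass G ℝ) (ε : Reals.Carrier ℝ) where
  open Reals ℝ
  open OrderedFieldFacts ℝ
  open GraphFacts G
  open Graph G using (Adj; adj?)
  open Mass m
  open IsCommutativeRing isCommutativeRing using (+-comm; +-assoc; +-identityʳ)

  Avoids : List V → V → Set
  Avoids T v = All (λ t → ¬ Reach G 2 t v) T

  avoids? : ∀ T v → Dec (Avoids T v)
  avoids? T v = All.all? (λ t → ¬? (reach? 2 t v)) T

  avoiding : List V → VSet G → VSet G
  avoiding T X = subsetOf (λ v → (v ∈? X) ×-dec avoids? T v)

  ∈-avoiding⁻ : ∀ {T X v} → v ∈ avoiding T X → v ∈ X × Avoids T v
  ∈-avoiding⁻ {T} {X} = ∈-subsetOf⁻ (λ v → (v ∈? X) ×-dec avoids? T v)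

  ∈-avoiding⁺ : ∀ {T X v} → v ∈ X → Avoids T v → v ∈ avoiding T X
  ∈-avoiding⁺ {T} {X} v∈X avoid = ∈-subsetOf⁺ (λ v → (v ∈? X) ×-dec avoids? T v) (v∈X , avoid)

  module _ (light-balls : ∀ t → μ (ball t) < ε) where

    mass-avoiding : ∀ T X → μ X ≤ μ (avoiding T X) + length T ×ℕ ε
    mass-avoiding [] X =
      subst (μ X ≤_) (sym (+-identityʳ _)) (μ-mono (λ v∈X → ∈-avoiding⁺ {[]} v∈X []))
    mass-avoiding (t ∷ T) X =
      ≤-trans split (≤-trans (+-mono-≤′ rest (inj₁ (light-balls t))) (inj₂ rearrange))
      where
        Y = avoiding (t ∷ []) X
        X⊆Y∪ball : X ⊆ Y ∪ ball t
        X⊆Y∪ball {v} v∈X with reach? 2 t v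
        ... | yes t→v = x∈p∪q⁺ (inj₂ (∈-subsetOf⁺ (reach? 2 t) t→v))
        ... | no t↛v = x∈p∪q⁺ (inj₁ (∈-avoiding⁺ v∈X (t↛v ∷ [])))
        Y-ball-disjoint : Disjoint G Y (ball t)
        Y-ball-disjoint v v∈Y v∈ball with ∈-avoiding⁻ {t ∷ []} v∈Y
        ... | _ , (t↛v ∷ []) = t↛v (∈-subsetOf⁻ (reach? 2 t) v∈ball)
        split : μ X ≤ μ Y + μ (ball t)
        split = ≤-trans (μ-mono X⊆Y∪ball) (μ-subadd Y (ball t) Y-ball-disjoint)
        avoiding-avoiding : avoiding T Y ⊆ avoiding (t ∷ T) X
        avoiding-avoiding v∈ with ∈-avoiding⁻ {T} v∈
        ... | v∈Y , avoidT with ∈-avoiding⁻ {t ∷ []} v∈Y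
        ...   | v∈X , (t↛v ∷ []) = ∈-avoiding⁺ v∈X (t↛v ∷ avoidT)
        rest : μ Y ≤ μ (avoiding (t ∷ T) X) + length T ×ℕ ε
        rest = ≤-trans (mass-avoiding T Y) (+-monoˡ-≤ _ (μ-mono avoiding-avoiding))
        rearrange : (μ (avoiding (t ∷ T) X) + length T ×ℕ ε) + ε ≡
                    μ (avoiding (t ∷ T) X) + suc (length T) ×ℕ ε
        rearrange = trans (+-assoc _ _ _) (cong (μ (avoiding (t ∷ T) X) +_) (+-comm _ ε))

    avoiding-heavy : 0r < ε → ∀ k T X → k ×ℕ ε ≤ μ X → length T ℕ.< k → ¬ μ (avoiding T X) < ε
    avoiding-heavy 0<ε k T X kε≤μX |T|<k light =
      <-irrefl _ (≤-<-trans (mass-avoiding T X)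
        (<-≤-trans (+-mono-< (length T ×ℕ ε) light) (≤-trans (×ℕ-mono (inj₁ 0<ε) |T|<k) kε≤μX)))

  heavy-sets-adjacent : (∀ X Y → Disjoint G X Y → Anticomplete G X Y → μ X < ε ⊎ μ Y < ε) →
                        ∀ X Y → Disjoint G X Y → ¬ μ X < ε → ¬ μ Y < ε →
                        ∃[ u ] ∃[ v ] (u ∈ X × v ∈ Y × Adj u v)
  heavy-sets-adjacent coherent X Y disj heavyX heavyY
    with any? (λ u → any? (λ v → (u ∈? X) ×-dec ((v ∈? Y) ×-dec adj? u v)))
  ... | yes (u , v , edge) = u , v , edge
  ... | no none with coherent X Y disj (λ u v u∈X v∈Y u~v → none (u , v , u∈X , v∈Y , u~v))
  ...   | inj₁ lightX = ⊥-elim (heavyX lightX)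
  ...   | inj₂ lightY = ⊥-elim (heavyY lightY)

length-concat-tabulate-≤ : ∀ {A : Set} {k c} (f : Fin k → List A) → (∀ j → length (f j) ℕ.≤ c) →
                           length (concat (List.tabulate f)) ℕ.≤ c * k
length-concat-tabulate-≤ {k = zero} f _ = ℕ.z≤n
length-concat-tabulate-≤ {k = suc k} {c} f bounded
  rewrite length-++ (f F.zero) {concat (List.tabulate (f ∘ F.suc))} | *-suc c k =
  +-mono-≤ (bounded F.zero) (length-concat-tabulate-≤ (f ∘ F.suc) (bounded ∘ F.suc))

length-concat-tabulate-< : ∀ {A : Set} {k c} (f : Fin k → List A) i →
                           (∀ j → length (f j) ℕ.≤ c) → length (f i) ℕ.< c →
                           length (concat (List.tabulate f)) ℕ.< c * k
length-concat-tabulate-< {k = suc k} {c} f i bounded short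
  rewrite length-++ (f F.zero) {concat (List.tabulate (f ∘ F.suc))} | *-suc c k with i
... | F.zero = ℕₚ.+-mono-<-≤ short (length-concat-tabulate-≤ (f ∘ F.suc) (bounded ∘ F.suc))
... | F.suc i′ =
  ℕₚ.+-mono-≤-< (bounded F.zero) (length-concat-tabulate-< (f ∘ F.suc) i′ (bounded ∘ F.suc) short)

module LadderLinkage
  (ℝ : Reals) (G : Graph) (mass : Mass G ℝ) (ε : Reals.Carrier ℝ)
  (0<ε : Reals._<_ ℝ (Reals.0r ℝ) ε) (coherent : Coherent G ℝ mass ε 2)
  {k : ℕ} (A B C : Fin k → VSet G) (ladder : IsLadder G A B C)
  (heavy-C : ∀ i → Reals._≤_ ℝ (Reals._×ℕ_ ℝ (3 * k) ε) (Mass.μ mass (C i)))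
  (b : Fin k → Fin (Graph.n G)) (b∈B : ∀ i → b i ∈ B i)
  (b-nonadjacent : ∀ i j → i ≢ j → ¬ Graph.Adj G (b i) (b j)) where
  open Reals ℝ using (_<_)
  open Graph G
  open GraphFacts G
  open MassFacts ℝ G mass ε
  open IsLadder ladder
  open Mass mass using (μ)

  Z : VSet G
  Z = (⋃ G A ∪ ⋃ G B) ∪ ⋃ G C

  other-rung : ∀ {s t : Fin 3} {i j : Fin k} → i ≢ j → (s , i) ≢ (t , j)
  other-rung i≢j refl = i≢j refl

  b-injective : ∀ {i j} → b i ≡ b j → i ≡ j
  b-injective {i} {j} bi≡bj with i ≟F j
  ... | yes i≡j = i≡j
  ... | no i≢j = ⊥-elim (pairwiseDisjoint (F.suc F.zero) i (F.suc F.zero) j (other-rung i≢j)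
                          (b i) (b∈B i) (subst (_∈ B j) (sym bi≡bj) (b∈B j)))

  BC : Fin k → V → Set
  BC i u = u ∈ B i ⊎ u ∈ C i

  A-far-from-other-rungs : ∀ {i j u v} → i ≢ j → u ∈ A i → v ∈ A j ⊎ BC j v → Far u v
  A-far-from-other-rungs {i} {j} {u} {v} i≢j u∈A v∈rung =
    distinct v∈rung , A-anti-other i j i≢j u v u∈A (∈rung v∈rung)
    where
      ∈rung : v ∈ A j ⊎ BC j v → v ∈ (A j ∪ B j) ∪ C j
      ∈rung (inj₁ v∈A) = x∈p∪q⁺ (inj₁ (x∈p∪q⁺ (inj₁ v∈A)))
      ∈rung (inj₂ (inj₁ v∈B)) = x∈p∪q⁺ (inj₁ (x∈p∪q⁺ (inj₂ v∈B)))
      ∈rung (inj₂ (inj₂ v∈C)) = x∈p∪q⁺ (inj₂ v∈C)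
      distinct : v ∈ A j ⊎ BC j v → u ≢ v
      distinct (inj₁ v∈A) refl =
        pairwiseDisjoint F.zero i F.zero j (other-rung i≢j) u u∈A v∈A
      distinct (inj₂ (inj₁ v∈B)) refl =
        pairwiseDisjoint F.zero i (F.suc F.zero) j (other-rung i≢j) u u∈A v∈B
      distinct (inj₂ (inj₂ v∈C)) refl =
        pairwiseDisjoint F.zero i (F.suc (F.suc F.zero)) j (other-rung i≢j) u u∈A v∈C

  -- The paths through b i stay on the i-th rung: they use A i freely, but of
  -- B i ∪ C i only b i and a short list s of extra vertices.
  OnRung : Fin k → List V → V → Set
  OnRung i s u = u ∈ A i ⊎ ((u ≡ b i ⊎ u ∈ₗ s) × BC i u)

  onRung-in-Z : ∀ {i s u} → OnRung i s u → u ∈ Z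
  onRung-in-Z {i} (inj₁ u∈A) = x∈p∪q⁺ (inj₁ (x∈p∪q⁺ (inj₁ (∈-⋃ A i u∈A))))
  onRung-in-Z {i} (inj₂ (_ , inj₁ u∈B)) = x∈p∪q⁺ (inj₁ (x∈p∪q⁺ (inj₂ (∈-⋃ B i u∈B))))
  onRung-in-Z {i} (inj₂ (_ , inj₂ u∈C)) = x∈p∪q⁺ (inj₂ (∈-⋃ C i u∈C))

  -- Every vertex c of C i is joined to b i by a walk along the rung, via a
  -- neighbour b′ ∈ B i of c and the connected set A i.
  rung-walk : ∀ i {c} → c ∈ C i → ∃[ b′ ] (Adj b′ c × Walk (OnRung i (b′ ∷ c ∷ [])) c (b i))
  rung-walk i {c} c∈C with B-covers-C i c c∈C
  ... | b′ , b′∈B , b′~c with A-covers-B i b′ b′∈B | A-covers-B i (b i) (b∈B i)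
  ... | a , a∈A , a~b′ | a₀ , a₀∈A , a₀~b =
    b′ , b′~c ,
    step (inj₂ (inj₂ (there (here refl)) , inj₂ c∈C)) (adj-sym b′~c)
      (step (inj₂ (inj₂ (here refl) , inj₁ b′∈B)) (adj-sym a~b′)
        (walkIn⇒walk inj₁ (A-connected i a a₀ a∈A a₀∈A)
          ++W step (inj₁ a₀∈A) a₀~b (here (inj₂ (inj₁ refl , inj₁ (b∈B i))))))

  linking-path : ∀ {i j si sj ci cj} →
                 Walk (OnRung i si) ci (b i) → Walk (OnRung j sj) cj (b j) → Adj ci cj →
                 Σ (InducedPathIn G Z (b i) (b j)) λ P → ∀ u → _∈P_ G u P → OnRung i si u ⊎ OnRung j sj u
  linking-path {i} {j} {si} {sj} Wi Wj ci~cj with walk⇒inducedList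
      (reverseWalk (mapWalk inj₁ Wi) ++W step (inj₁ (walk-start Wi)) ci~cj (mapWalk inj₂ Wj))
  ... | xs , P , on-rungs =
    toInducedPathIn P in-Z , λ u u∈P → All.lookup on-rungs (∈-toInducedPathIn P in-Z u∈P)
    where
      in-Z : All (_∈ Z) (b i ∷ xs)
      in-Z = All.map [ onRung-in-Z {i} {si} , onRung-in-Z {j} {sj} ]′ on-rungs

  -- If fewer than 3k vertices are used so far, there is an edge between C i
  -- and C j far from all of them: deleting their 2-balls leaves mass ≥ ε in
  -- each C, and coherence forbids two such sets to be anticomplete.
  far-rung-edge : ∀ T {i j} → i ≢ j → length T ℕ.< 3 * k →
                  ∃[ ci ] ∃[ cj ] ((ci ∈ C i × Avoids T ci) × (cj ∈ C j × Avoids T cj) × Adj ci cj)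
  far-rung-edge T {i} {j} i≢j T-short with heavy-sets-adjacent (proj₂ coherent)
      (avoiding T (C i)) (avoiding T (C j)) disjoint (heavy i) (heavy j)
    where
      heavy : ∀ m → ¬ μ (avoiding T (C m)) < ε
      heavy m = avoiding-heavy (λ t → proj₁ coherent t (ball t) (ball-isBall t)) 0<ε
                  (3 * k) T (C m) (heavy-C m) T-short
      disjoint : Disjoint G (avoiding T (C i)) (avoiding T (C j))
      disjoint v v∈i v∈j =
        pairwiseDisjoint (F.suc (F.suc F.zero)) i (F.suc (F.suc F.zero)) j (other-rung i≢j) v
          (proj₁ (∈-avoiding⁻ {T} v∈i)) (proj₁ (∈-avoiding⁻ {T} v∈j))
  ... | ci , cj , ci∈ , cj∈ , ci~cj = ci , cj , ∈-avoiding⁻ {T} ci∈ , ∈-avoiding⁻ {T} cj∈ , ci~cj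

  _∈ᵢ_ : Fin k → Block G → Set
  i ∈ᵢ blk = _∈B_ G (b i) blk

  -- A pairing of the b's, except that not every b i need be covered.
  record PartialPairing (L : List (Block G)) : Set where
    field
      blocks-of-b : ∀ e u → _∈B_ G u (List.lookup L e) → ∃[ i ] (b i ≡ u)
      pair-distinct : ∀ e x y → List.lookup L e ≡ pair x y → x ≢ y
      blocks-disjoint : ∀ e f → e ≢ f → ∀ u →
                        _∈B_ G u (List.lookup L e) → ¬ _∈B_ G u (List.lookup L f)

  partialPairing-tail : ∀ {blk L} → PartialPairing (blk ∷ L) → PartialPairing L
  partialPairing-tail pp = record
    { blocks-of-b = λ e → blocks-of-b (F.suc e)
    ; pair-distinct = λ e → pair-distinct (F.suc e)
    ; blocks-disjoint = λ e f e≢f →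
        blocks-disjoint (F.suc e) (F.suc f) (e≢f ∘ Fin-suc-injective) }
    where open PartialPairing pp

  Owned : (L : List (Block G)) → (Fin k → List V) → Fin (length L) → V → Set
  Owned L extra e u = ∃[ i ] (i ∈ᵢ List.lookup L e × OnRung i (extra i) u)

  -- The invariant of the construction: paths for the blocks of L lying on
  -- their rungs, where rung i uses at most two extra vertices of B i ∪ C i;
  -- extra vertices of different blocks are far apart, and far from all b's.
  record Linkage (L : List (Block G)) : Set where
    field
      extra : Fin k → List V
      path : (e : Fin (length L)) → BlockPath G Z (List.lookup L e)
      extra-short : ∀ m → length (extra m) ℕ.≤ 2
      extra-unused : ∀ m → (∀ e → ¬ m ∈ᵢ List.lookup L e) → extra m ≡ []
      owned : ∀ e u → blockPathVertex G (List.lookup L e) (path e) u → Owned L extra e u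
      extras-far : ∀ e f → e ≢ f → ∀ i m → i ∈ᵢ List.lookup L e → m ∈ᵢ List.lookup L f →
                   ∀ {u v} → u ∈ₗ extra i → v ∈ₗ extra m → Far u v
      extras-far-from-b : ∀ m {u} → u ∈ₗ extra m → ∀ i → Far u (b i)

  no-blocks : Linkage []
  no-blocks = record
    { extra = λ _ → [] ; path = λ () ; extra-short = λ _ → ℕ.z≤n ; extra-unused = λ _ _ → refl
    ; owned = λ () ; extras-far = λ () ; extras-far-from-b = λ _ () }

  usedVertices : ∀ {L} → Linkage L → List V
  usedVertices lk = concat (List.tabulate (λ m → b m ∷ Linkage.extra lk m))

  ∈-usedVertices : ∀ {L} (lk : Linkage L) m {v} → v ∈ₗ b m ∷ Linkage.extra lk m →
                   v ∈ₗ usedVertices lk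
  ∈-usedVertices lk m v∈ = ∈-concat⁺′ v∈ (∈-tabulate⁺ m)

  usedVertices-short : ∀ {L} (lk : Linkage L) i → Linkage.extra lk i ≡ [] →
                       length (usedVertices lk) ℕ.< 3 * k
  usedVertices-short lk i unused =
    length-concat-tabulate-< _ i (λ m → ℕ.s≤s (Linkage.extra-short lk m))
      (subst (λ s → length (b i ∷ s) ℕ.< 3) (sym unused) (ℕ.s≤s (ℕ.s≤s ℕ.z≤n)))

  head-unused : ∀ {blk L m} → PartialPairing (blk ∷ L) → (lk : Linkage L) → m ∈ᵢ blk →
                Linkage.extra lk m ≡ []
  head-unused pp lk now = Linkage.extra-unused lk _ (λ f later →
    PartialPairing.blocks-disjoint pp F.zero (F.suc f) (λ ()) _ now later)

  record Extension (blk : Block G) {L} (old : Linkage L) : Set where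
    field
      extra : Fin k → List V
      extra-old : ∀ m → ¬ m ∈ᵢ blk → extra m ≡ Linkage.extra old m
      extra-short : ∀ m → m ∈ᵢ blk → length (extra m) ℕ.≤ 2
      path : BlockPath G Z blk
      owned : ∀ u → blockPathVertex G blk path u → ∃[ i ] (i ∈ᵢ blk × OnRung i (extra i) u)
      new-far-used : ∀ i → i ∈ᵢ blk → ∀ {u} → u ∈ₗ extra i → ∀ {v} → v ∈ₗ usedVertices old → Far u v

  extend : ∀ {blk L} → PartialPairing (blk ∷ L) → (old : Linkage L) → Extension blk old →
           Linkage (blk ∷ L)
  extend {blk} {L} pp old ext = record
    { extra = New.extra
    ; path = path
    ; extra-short = extra-short
    ; extra-unused = λ m unused →
        trans (New.extra-old m (unused F.zero)) (Old.extra-unused m (unused ∘ F.suc))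
    ; owned = owned
    ; extras-far = extras-far
    ; extras-far-from-b = extras-far-from-b }
    where
      module Old = Linkage old
      module New = Extension ext

      -- indices of the old blocks are not in blk, so keep their extra vertices
      same-extra : ∀ {m} f → m ∈ᵢ List.lookup L f → New.extra m ≡ Old.extra m
      same-extra f later = New.extra-old _ λ now →
        PartialPairing.blocks-disjoint pp F.zero (F.suc f) (λ ()) _ now later

      ∈-old-extra : ∀ {m} f → m ∈ᵢ List.lookup L f →
                    ∀ {u} → u ∈ₗ New.extra m → u ∈ₗ Old.extra m
      ∈-old-extra f later = subst (_ ∈ₗ_) (same-extra f later)

      path : (e : Fin (length (blk ∷ L))) → BlockPath G Z (List.lookup (blk ∷ L) e)
      path F.zero = New.path
      path (F.suc e) = Old.path e

      extra-short : ∀ m → length (New.extra m) ℕ.≤ 2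
      extra-short m with b m ∈B? blk
      ... | yes now = New.extra-short m now
      ... | no notNow rewrite New.extra-old m notNow = Old.extra-short m

      owned : ∀ e u → blockPathVertex G (List.lookup (blk ∷ L) e) (path e) u →
              Owned (blk ∷ L) New.extra e u
      owned F.zero u u∈ = New.owned u u∈
      owned (F.suc e) u u∈ with Old.owned e u u∈
      ... | i , later , on-rung =
        i , later , subst (λ s → OnRung i s u) (sym (same-extra e later)) on-rung

      extras-far : ∀ e f → e ≢ f → ∀ i m →
                   i ∈ᵢ List.lookup (blk ∷ L) e → m ∈ᵢ List.lookup (blk ∷ L) f →
                   ∀ {u v} → u ∈ₗ New.extra i → v ∈ₗ New.extra m → Far u v
      extras-far F.zero F.zero e≢f = ⊥-elim (e≢f refl)
      extras-far F.zero (F.suc f) _ i m now later u∈ v∈ =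
        New.new-far-used i now u∈ (∈-usedVertices old m (there (∈-old-extra f later v∈)))
      extras-far (F.suc e) F.zero _ i m later now u∈ v∈ =
        far-sym (New.new-far-used m now v∈ (∈-usedVertices old i (there (∈-old-extra e later u∈))))
      extras-far (F.suc e) (F.suc f) e≢f i m later later′ u∈ v∈ =
        Old.extras-far e f (e≢f ∘ cong F.suc) i m later later′
          (∈-old-extra e later u∈) (∈-old-extra f later′ v∈)

      extras-far-from-b : ∀ m {u} → u ∈ₗ New.extra m → ∀ i → Far u (b i)
      extras-far-from-b m u∈ i with b m ∈B? blk
      ... | yes now = New.new-far-used m now u∈ (∈-usedVertices old i (here refl))
      ... | no notNow = Old.extras-far-from-b m (subst (_ ∈ₗ_) (New.extra-old m notNow) u∈) i

  single-extension : ∀ i {L} (old : Linkage L) → Linkage.extra old i ≡ [] →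
                     Extension (single (b i)) old
  single-extension i old unused = record
    { extra = Linkage.extra old
    ; extra-old = λ _ _ → refl
    ; extra-short = λ m _ → Linkage.extra-short old m
    ; path = toInducedPathIn end (b∈Z ∷ []) , refl
    ; owned = λ { u (F.zero , refl) → i , refl , inj₂ (inj₁ refl , inj₁ (b∈B i)) }
    ; new-far-used = λ m m∈ u∈ → ⊥-elim (¬Any[] (subst (_ ∈ₗ_) (unused-at m∈) u∈)) }
    where
      b∈Z : b i ∈ Z
      b∈Z = onRung-in-Z {i} {[]} (inj₂ (inj₁ refl , inj₁ (b∈B i)))
      unused-at : ∀ {m} → m ∈ᵢ single (b i) → Linkage.extra old m ≡ []
      unused-at bm≡bi rewrite b-injective bm≡bi = unused

  pair-extension-from : ∀ {i j L} → i ≢ j → (old : Linkage L) → (si sj : List V) →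
                        length si ℕ.≤ 2 → length sj ℕ.≤ 2 →
                        (∀ {u} → u ∈ₗ si ⊎ u ∈ₗ sj → ∀ {v} → v ∈ₗ usedVertices old → Far u v) →
                        (P : InducedPathIn G Z (b i) (b j)) →
                        (∀ u → _∈P_ G u P → OnRung i si u ⊎ OnRung j sj u) →
                        Extension (pair (b i) (b j)) old
  pair-extension-from {i} {j} i≢j old si sj si-short sj-short new-far P on-rungs = record
    { extra = extra
    ; extra-old = λ m m∉ → extra-other m (λ { refl → m∉ (inj₁ refl) }) (λ { refl → m∉ (inj₂ refl) })
    ; extra-short = λ m → extra-new-short
    ; path = P
    ; owned = owned
    ; new-far-used = λ m m∈ u∈ → new-far (∈-extra-new m∈ u∈) }
    where
      extra : Fin k → List V
      extra = updateAt (updateAt (Linkage.extra old) i (const si)) j (const sj)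

      extra-i : extra i ≡ si
      extra-i = trans (updateAt-minimal i j _ i≢j) (updateAt-updates i _)

      extra-j : extra j ≡ sj
      extra-j = updateAt-updates j _

      extra-other : ∀ m → m ≢ i → m ≢ j → extra m ≡ Linkage.extra old m
      extra-other m m≢i m≢j = trans (updateAt-minimal m j _ m≢j) (updateAt-minimal m i _ m≢i)

      extra-new : ∀ {m} → m ∈ᵢ pair (b i) (b j) → extra m ≡ si ⊎ extra m ≡ sj
      extra-new (inj₁ bm≡bi) rewrite b-injective bm≡bi = inj₁ extra-i
      extra-new (inj₂ bm≡bj) rewrite b-injective bm≡bj = inj₂ extra-j

      extra-new-short : ∀ {m} → m ∈ᵢ pair (b i) (b j) → length (extra m) ℕ.≤ 2
      extra-new-short m∈ with extra-new m∈
      ... | inj₁ eq rewrite eq = si-short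
      ... | inj₂ eq rewrite eq = sj-short

      ∈-extra-new : ∀ {m u} → m ∈ᵢ pair (b i) (b j) → u ∈ₗ extra m → u ∈ₗ si ⊎ u ∈ₗ sj
      ∈-extra-new m∈ u∈ with extra-new m∈
      ... | inj₁ eq = inj₁ (subst (_ ∈ₗ_) eq u∈)
      ... | inj₂ eq = inj₂ (subst (_ ∈ₗ_) eq u∈)

      owned : ∀ u → _∈P_ G u P → ∃[ m ] (m ∈ᵢ pair (b i) (b j) × OnRung m (extra m) u)
      owned u u∈ with on-rungs u u∈
      ... | inj₁ on-i = i , inj₁ refl , subst (λ s → OnRung i s u) (sym extra-i) on-i
      ... | inj₂ on-j = j , inj₂ refl , subst (λ s → OnRung j s u) (sym extra-j) on-j

  pair-extension : ∀ {i j L} → i ≢ j → (old : Linkage L) → Linkage.extra old i ≡ [] →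
                   Extension (pair (b i) (b j)) old
  pair-extension {i} {j} i≢j old unused
    with far-rung-edge (usedVertices old) i≢j (usedVertices-short old i unused)
  ... | ci , cj , (ci∈C , ci-avoids) , (cj∈C , cj-avoids) , ci~cj
    with rung-walk i ci∈C | rung-walk j cj∈C
  ... | b′i , b′i~ci , Wi | b′j , b′j~cj , Wj =
    pair-extension-from i≢j old (b′i ∷ ci ∷ []) (b′j ∷ cj ∷ []) ℕₚ.≤-refl ℕₚ.≤-refl
      new-far (proj₁ (linking-path Wi Wj ci~cj)) (proj₂ (linking-path Wi Wj ci~cj))
    where
      new-far : ∀ {u} → u ∈ₗ b′i ∷ ci ∷ [] ⊎ u ∈ₗ b′j ∷ cj ∷ [] → ∀ {v} → v ∈ₗ usedVertices old → Far u v
      new-far (inj₁ (here refl)) v∈ = far-neighbour (All.lookup ci-avoids v∈) b′i~ci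
      new-far (inj₁ (there (here refl))) v∈ = far-centre (All.lookup ci-avoids v∈)
      new-far (inj₂ (here refl)) v∈ = far-neighbour (All.lookup cj-avoids v∈) b′j~cj
      new-far (inj₂ (there (here refl))) v∈ = far-centre (All.lookup cj-avoids v∈)

  linkage : ∀ L → PartialPairing L → Linkage L
  linkage [] _ = no-blocks
  linkage (single x ∷ L) pp with PartialPairing.blocks-of-b pp F.zero x refl
  ... | i , refl = extend pp old (single-extension i old (head-unused pp old refl))
    where old = linkage L (partialPairing-tail pp)
  linkage (pair x y ∷ L) pp with PartialPairing.blocks-of-b pp F.zero x (inj₁ refl)
                               | PartialPairing.blocks-of-b pp F.zero y (inj₂ refl)
  ... | i , refl | j , refl = extend pp old (pair-extension i≢j old (head-unused pp old (inj₁ refl)))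
    where
      old = linkage L (partialPairing-tail pp)
      i≢j : i ≢ j
      i≢j i≡j = PartialPairing.pair-distinct pp F.zero (b i) (b j) refl (cong b i≡j)

  -- The paths of a linkage are pairwise far apart: vertices on different
  -- rungs are far by the ladder axioms, two b's are distinct and nonadjacent,
  -- and extra vertices are far from b's and from extras of other blocks.
  linkage-feasible : ∀ {L} → PartialPairing L → Linkage L → Feasible G Z L
  linkage-feasible {L} pp lk =
    path , λ e f e≢f → (λ u u∈e u∈f → proj₁ (separated e f e≢f u∈e u∈f) refl)
                     , (λ u v u∈e v∈f → proj₂ (separated e f e≢f u∈e v∈f))
    where
      open Linkage lk

      separated : ∀ e f → e ≢ f → ∀ {u v} → blockPathVertex G (List.lookup L e) (path e) u →
                  blockPathVertex G (List.lookup L f) (path f) v → Far u v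
      separated e f e≢f {u} {v} u∈e v∈f with owned e u u∈e | owned f v v∈f
      ... | i , i∈e , u-on | m , m∈f , v-on = on-rungs u-on v-on
        where
          i≢m : i ≢ m
          i≢m refl = PartialPairing.blocks-disjoint pp e f e≢f (b i) i∈e m∈f

          BC-of : ∀ {w} → OnRung m (extra m) w → w ∈ A m ⊎ BC m w
          BC-of (inj₁ w∈A) = inj₁ w∈A
          BC-of (inj₂ (_ , w∈BC)) = inj₂ w∈BC

          on-rungs : OnRung i (extra i) u → OnRung m (extra m) v → Far u v
          on-rungs (inj₁ u∈A) v-on = A-far-from-other-rungs i≢m u∈A (BC-of v-on)
          on-rungs (inj₂ (_ , u∈BC)) (inj₁ v∈A) =
            far-sym (A-far-from-other-rungs (i≢m ∘ sym) v∈A (inj₂ u∈BC))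
          on-rungs (inj₂ (inj₁ refl , _)) (inj₂ (inj₁ refl , _)) =
            (i≢m ∘ b-injective) , b-nonadjacent i m i≢m
          on-rungs (inj₂ (inj₁ refl , _)) (inj₂ (inj₂ v∈ , _)) = far-sym (extras-far-from-b m v∈ i)
          on-rungs (inj₂ (inj₂ u∈ , _)) (inj₂ (inj₁ refl , _)) = extras-far-from-b i u∈ m
          on-rungs (inj₂ (inj₂ u∈ , _)) (inj₂ (inj₂ v∈ , _)) = extras-far e f e≢f i m i∈e m∈f u∈ v∈

mainTheorem12 : (ℝ : Reals) (G : Graph) (μ : Mass G ℝ) (ε : Reals.Carrier ℝ) (k : ℕ) →
    Reals._<_ ℝ (Reals.0r ℝ) ε →
    Coherent G ℝ μ ε 2 →
    (A B C : Fin k → VSet G) →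
    IsLadder G A B C →
    (∀ i → Reals._≤_ ℝ (Reals._×ℕ_ ℝ (3 * k) ε) (Mass.μ μ (C i))) →
    (b : Fin k → Fin (Graph.n G)) →
    (∀ i → b i ∈ B i) →
    (∀ i j → i ≢ j → ¬ Graph.Adj G (b i) (b j)) →
    (Π : List (Block G)) →
    IsPairing G (λ u → ∃[ i ] (b i ≡ u)) Π →
    Feasible G ((⋃ G A ∪ ⋃ G B) ∪ ⋃ G C) Π
mainTheorem12 ℝ G μ ε k 0<ε coherent A B C ladder heavy-C b b∈B b-nonadjacent Π isPairing =
  linkage-feasible partial (linkage Π partial)
  where
    open LadderLinkage ℝ G μ ε 0<ε coherent A B C ladder heavy-C b b∈B b-nonadjacent
    open IsPairing isPairing
    partial : PartialPairing Π
    partial = record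
      { blocks-of-b = blocks-⊆ ; pair-distinct = pair-distinct ; blocks-disjoint = blocks-disjoint }
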